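{- Let $F$ be a finite family of intervals and let $s$ and $t$ be distinct minimal bad intervals for $F$. Then $(F\downarrow s)\downarrow t=(F\downarrow t)\downarrow s$.
   Context: For integers $a<b$, $[a,b)=\{x\in\mathbb{Z}: a\le x<b\}$; an interval is a nonempty set of this form. A family is a finite set of intervals. For a set $s$, $F|s=\{f\in F: f\subseteq s\}$. For an integer $x$, $N_x F$ is the number of members of $F$ containing $x$. An interval $s$ is good for $F$ if $N_x(F|s)\le 1$ for some $x\in s$, and bad otherwise; a minimal bad interval is a bad interval containing no other bad interval. Given an interval $s$, let $[a_1,b_1),\dots,[a_k,b_k)$ be the inclusion-maximal members of $F|s$, ordered so that $a_1<\dots<a_k$ (then $b_1<\dots<b_k$). If $a_{j+1}<b_j$ for $1\le j<k$, define $F\downarrow s=(F\setminus\{[a_1,b_1),\dots,[a_k,b_k)\})\cup\{[a_2,b_1),\dots,[a_k,b_{k-1})\}$; this condition holds whenever $s$ is a minimal bad interval for $F$, so $F\downarrow s$ is then defined. -}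

module Defs where

open import Data.Integer using (ℤ; _≤_; _<_; _≤?_; _<?_)
import Data.Integer.Properties as ℤP
open import Data.Nat using (ℕ)
import Data.Nat as ℕ
open import Data.Product using (_×_; _,_; ∃)
open import Data.Product.Properties using (≡-dec)
open import Data.Product.Relation.Binary.Lex.NonStrict using (×-decTotalOrder)
open import Data.List using (List; []; _∷_; filter; length; map; deduplicate; _++_)
open import Data.List.Relation.Unary.All using (All)
open import Data.List.Relation.Unary.Any using (any?)
import Data.List.Membership.DecPropositional as DecMem
open import Data.List.Sort (×-decTotalOrder ℤP.≤-decTotalOrder ℤP.≤-decTotalOrder) using (sort)
open import Relation.Binary.PropositionalEquality using (_≡_; _≢_)
open import Relation.Binary.Definitions using (DecidableEquality)
open import Relation.Nullary using (¬_; Dec; ¬?)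
open import Relation.Nullary.Decidable using (_×-dec_)

-- An interval [a,b) is represented by the pair (a , b); it is nonempty iff a < b.
Interval : Set
Interval = ℤ × ℤ

IsInterval : Interval → Set
IsInterval (a , b) = a < b

_≟ᵢ_ : DecidableEquality Interval
_≟ᵢ_ = ≡-dec ℤP._≟_ ℤP._≟_

open DecMem _≟ᵢ_ using (_∈?_) public

-- A family is a finite set of intervals: a duplicate-free list of nonempty intervals
-- (these side conditions are hypotheses of the theorem).
Family : Set
Family = List Interval

_∋_ : Interval → ℤ → Set
(a , b) ∋ x = a ≤ x × x < b

_∋?_ : (I : Interval) (x : ℤ) → Dec (I ∋ x)
(a , b) ∋? x = (a ≤? x) ×-dec (x <? b)

_⊆ᵢ_ : Interval → Interval → Set
(a , b) ⊆ᵢ (c , d) = c ≤ a × b ≤ d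

_⊆?_ : (I J : Interval) → Dec (I ⊆ᵢ J)
(a , b) ⊆? (c , d) = (c ≤? a) ×-dec (b ≤? d)

_⊂ᵢ_ : Interval → Interval → Set
I ⊂ᵢ J = I ⊆ᵢ J × I ≢ J

_⊂?_ : (I J : Interval) → Dec (I ⊂ᵢ J)
I ⊂? J = (I ⊆? J) ×-dec ¬? (I ≟ᵢ J)

restrict : Family → Interval → Family
restrict F s = filter (λ I → I ⊆? s) F

N : ℤ → Family → ℕ
N x F = length (filter (λ I → I ∋? x) F)

Good : Family → Interval → Set
Good F s = ∃ λ x → s ∋ x × N x (restrict F s) ℕ.≤ 1

Bad : Family → Interval → Set
Bad F s = ¬ Good F s

MinimalBad : Family → Interval → Set
MinimalBad F s =
  IsInterval s × Bad F s × (∀ t → IsInterval t → t ⊆ᵢ s → t ≢ s → ¬ Bad F t)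

-- inclusion-maximal members of F|s, sorted by left endpoint
-- (lexicographic order; maximal members have distinct left endpoints)
maximals : Family → Interval → List Interval
maximals F s = sort (filter (λ I → ¬? (any? (λ J → I ⊂? J) G)) G)
  where G = restrict F s

consecutive : {A : Set} → List A → List (A × A)
consecutive (x ∷ y ∷ xs) = (x , y) ∷ consecutive (y ∷ xs)
consecutive _ = []

-- the condition a_{j+1} < b_j for 1 ≤ j < k, under which F↓s is defined
DownDefined : Family → Interval → Set
DownDefined F s = All (λ { ((a₁ , b₁) , (a₂ , b₂)) → a₂ < b₁ }) (consecutive (maximals F s))

infixl 6 _↓_
infix 4 _≈F_

_↓_ : Family → Interval → Family
F ↓ s = deduplicate _≟ᵢ_
  (filter (λ I → ¬? (I ∈? M)) F ++ map (λ { ((a₁ , b₁) , (a₂ , b₂)) → (a₂ , b₁) }) (consecutive M))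
  where M = maximals F s

_≈F_ : Family → Family → Set
F ≈F G = ∀ I → (I Data.List.Membership.Propositional.∈ F → I Data.List.Membership.Propositional.∈ G)
             × (I Data.List.Membership.Propositional.∈ G → I Data.List.Membership.Propositional.∈ F)
  where import Data.List.Membership.Propositional

-- Write s = [p, q) and t = [p', q') with p < p'; then q < q', since t ⊄ s. Minimality of s
-- says two things about consecutive maximal members A, B of F|s: they overlap, and their
-- overlap [a_B, b_A) is not already a member of F, for otherwise the proper prefix [p, b_A)
-- of s would be bad. The reductions ↓s and ↓t interact only through a member X maximal in
-- both F|s and F|t. Such an X lies in u = [p', q), a proper subinterval of s and hence good,
-- and contains every point of u covered at most once by F|u, so X is unique. Determining the
-- maximal members of (F ↓ s)|t and of (F ↓ t)|s then shows that both double reductions consist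
-- of the members of F maximal in neither F|s nor F|t, the overlaps of consecutive maximal
-- members of F|s other than [a_X, b_A) and of F|t other than [a_B, b_X), and the interval
-- [a_B, b_A), where A is the predecessor of X in F|s and B its successor in F|t.

module Submission where

open import Defs
open import Data.Empty using (⊥; ⊥-elim)
open import Data.Integer using (ℤ; _≤_; _<_; _≤?_; _<?_; _-_)
import Data.Integer.Properties as ℤ
open import Data.Integer.Properties
  using (≤-refl; ≤-trans; ≤-antisym; ≤-total; ≤-reflexive; <⇒≤; <-irrefl; <-asym; <-trans;
         ≤-<-trans; <-≤-trans; ≰⇒>; ≮⇒≥; <-cmp)
open import Data.List using (List; []; _∷_; filter; length)
open import Data.List.Extrema ℤ.≤-totalOrder using (argmax; argmax-all; f[xs]≤f[argmax])
open import Data.List.Membership.Propositional using (_∈_; lose; find)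
open import Data.List.Membership.Propositional.Properties
  using (∈-filter⁺; ∈-filter⁻; ∈-map⁺; ∈-map⁻; ∈-++⁺ˡ; ∈-++⁺ʳ; ∈-++⁻; ∈-deduplicate⁺; ∈-deduplicate⁻;
         ∈-length)
open import Data.List.Relation.Binary.Permutation.Propositional using (↭-sym; ↭⇒↭ₛ)
open import Data.List.Relation.Binary.Permutation.Propositional.Properties using (∈-resp-↭)
open import Data.List.Relation.Unary.All using (All; []; _∷_)
import Data.List.Relation.Unary.All as All
open import Data.List.Relation.Unary.AllPairs using (AllPairs; []; _∷_)
open import Data.List.Relation.Unary.Any using (here; there; any?)
open import Data.List.Relation.Unary.Linked using (Linked; []; [-]; _∷_)
open import Data.List.Relation.Unary.Linked.Properties using (Linked⇒AllPairs)
open import Data.List.Relation.Unary.Unique.Propositional using (Unique)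
import Data.List.Relation.Unary.Unique.Propositional.Properties as Unique
open import Data.List.Relation.Unary.Unique.DecPropositional.Properties _≟ᵢ_ using (deduplicate-!)
import Data.Nat as ℕ
import Data.Nat.Properties as ℕₚ
open import Data.Product using (_×_; _,_; ∃; ∃₂; proj₁; proj₂; swap)
open import Data.Product.Relation.Binary.Lex.NonStrict using (×-decTotalOrder)
open import Data.List.Sort (×-decTotalOrder ℤ.≤-decTotalOrder ℤ.≤-decTotalOrder) using (sort-↭; sort-↗)
open import Data.Sum using (_⊎_; inj₁; inj₂)
open import Function using (case_of_; _on_)
open import Relation.Binary.Bundles using (DecTotalOrder)
open import Relation.Binary.Definitions using (tri<; tri≈; tri>)
open import Relation.Binary.PropositionalEquality
  using (_≡_; _≢_; refl; sym; trans; cong; cong₂; subst; setoid)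
open import Data.List.Relation.Binary.Permutation.Setoid.Properties (setoid Interval) using (Unique-resp-↭)
open import Relation.Nullary using (¬_; ¬?; Dec; yes; no)
open import Relation.Nullary.Decidable using (decidable-stable; _×-dec_; map′)
open import Relation.Unary using (_⊆_; _≐_)
open import Relation.Unary.Properties using (≐-sym; ≐-trans)

lft rgt : Interval → ℤ
lft = proj₁
rgt = proj₂

⊆ᵢ-refl : ∀ {I} → I ⊆ᵢ I
⊆ᵢ-refl = ≤-refl , ≤-refl

⊆ᵢ-trans : ∀ {I J K} → I ⊆ᵢ J → J ⊆ᵢ K → I ⊆ᵢ K
⊆ᵢ-trans (a , b) (c , d) = ≤-trans c a , ≤-trans b d

⊆ᵢ-antisym : ∀ {I J} → I ⊆ᵢ J → J ⊆ᵢ I → I ≡ J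
⊆ᵢ-antisym (a , b) (c , d) = cong₂ _,_ (≤-antisym c a) (≤-antisym b d)

⊆ᵢ∧lft<⇒⊂ᵢ : ∀ {I J} → I ⊆ᵢ J → lft J < lft I → I ⊂ᵢ J
⊆ᵢ∧lft<⇒⊂ᵢ sub lt = sub , λ eq → <-irrefl (sym (cong lft eq)) lt

⊆ᵢ∧rgt<⇒⊂ᵢ : ∀ {I J} → I ⊆ᵢ J → rgt I < rgt J → I ⊂ᵢ J
⊆ᵢ∧rgt<⇒⊂ᵢ sub lt = sub , λ eq → <-irrefl (cong rgt eq) lt

⊂ᵢ-⊆ᵢ-trans : ∀ {I J K} → I ⊂ᵢ J → J ⊆ᵢ K → I ⊂ᵢ K
⊂ᵢ-⊆ᵢ-trans (ij , I≢J) jk = ⊆ᵢ-trans ij jk , λ { refl → I≢J (⊆ᵢ-antisym ij jk) }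

∋-⊆ᵢ : ∀ {I J x} → I ∋ x → I ⊆ᵢ J → J ∋ x
∋-⊆ᵢ (a , b) (c , d) = ≤-trans c a , <-≤-trans b d

-- The argument works with families as predicates on intervals; `members` (below) turns the
-- list encoding into one, and `Down 𝔽 s` is the predicate version of F ↓ s.
Fam : Set₁
Fam = Interval → Set

Maximal : Fam → Interval → Interval → Set
Maximal 𝔽 s I = 𝔽 I × I ⊆ᵢ s × (∀ J → 𝔽 J → J ⊆ᵢ s → ¬ I ⊂ᵢ J)

Consecutive : Fam → Interval → Interval → Interval → Set
Consecutive 𝔽 s A B = Maximal 𝔽 s A × Maximal 𝔽 s B × lft A < lft B ×
  (∀ K → Maximal 𝔽 s K → lft A < lft K → lft K < lft B → ⊥)

Overlap : Fam → Interval → Interval → Set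
Overlap 𝔽 s I = ∃₂ λ A B → Consecutive 𝔽 s A B × I ≡ (lft B , rgt A)

Down : Fam → Interval → Fam
Down 𝔽 s I = (𝔽 I × ¬ Maximal 𝔽 s I) ⊎ Overlap 𝔽 s I

Covers : Fam → Interval → ℤ → Interval → Set
Covers 𝔽 v x A = 𝔽 A × A ⊆ᵢ v × A ∋ x

CoveredTwice : Fam → Interval → ℤ → Set
CoveredTwice 𝔽 v x = ∃₂ λ A B → A ≢ B × Covers 𝔽 v x A × Covers 𝔽 v x B

CoveredAtMostOnce : Fam → Interval → ℤ → Set
CoveredAtMostOnce 𝔽 v x = ∀ {A B} → Covers 𝔽 v x A → Covers 𝔽 v x B → A ≡ B

module Maximals (𝔾 : Fam) (s : Interval) where

  lft-injective : ∀ {A B} → Maximal 𝔾 s A → Maximal 𝔾 s B → lft A ≡ lft B → A ≡ B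
  lft-injective {A} {B} (gA , sA , mA) (gB , sB , mB) e with A ≟ᵢ B
  ... | yes A≡B = A≡B
  ... | no A≢B with ≤-total (rgt A) (rgt B)
  ... | inj₁ r = ⊥-elim (mA B gB sB ((≤-reflexive (sym e) , r) , A≢B))
  ... | inj₂ r = ⊥-elim (mB A gA sA ((≤-reflexive e , r) , λ q → A≢B (sym q)))

  rgt-injective : ∀ {A B} → Maximal 𝔾 s A → Maximal 𝔾 s B → rgt A ≡ rgt B → A ≡ B
  rgt-injective {A} {B} (gA , sA , mA) (gB , sB , mB) e with A ≟ᵢ B
  ... | yes A≡B = A≡B
  ... | no A≢B with ≤-total (lft A) (lft B)
  ... | inj₁ l = ⊥-elim (mB A gA sA ((l , ≤-reflexive (sym e)) , λ q → A≢B (sym q)))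
  ... | inj₂ l = ⊥-elim (mA B gB sB ((l , ≤-reflexive e) , A≢B))

  lft<⇒rgt< : ∀ {A B} → Maximal 𝔾 s A → Maximal 𝔾 s B → lft A < lft B → rgt A < rgt B
  lft<⇒rgt< {A} {B} (gA , sA , _) (_ , _ , mB) lt =
    decidable-stable (rgt A <? rgt B) λ r≮ → mB A gA sA (⊆ᵢ∧lft<⇒⊂ᵢ (<⇒≤ lt , ≮⇒≥ r≮) lt)

  rgt<⇒lft< : ∀ {A B} → Maximal 𝔾 s A → Maximal 𝔾 s B → rgt A < rgt B → lft A < lft B
  rgt<⇒lft< {A} {B} (_ , _ , mA) (gB , sB , _) lt =
    decidable-stable (lft A <? lft B) λ l≮ → mA B gB sB (⊆ᵢ∧rgt<⇒⊂ᵢ (≮⇒≥ l≮ , <⇒≤ lt) lt)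

  lft≤⇒rgt≤ : ∀ {A B} → Maximal 𝔾 s A → Maximal 𝔾 s B → lft A ≤ lft B → rgt A ≤ rgt B
  lft≤⇒rgt≤ {A} {B} mA mB le with <-cmp (lft A) (lft B)
  ... | tri< lt _ _ = <⇒≤ (lft<⇒rgt< mA mB lt)
  ... | tri≈ _ eq _ = ≤-reflexive (cong rgt (lft-injective mA mB eq))
  ... | tri> _ _ gt = ⊥-elim (<-irrefl refl (≤-<-trans le gt))

  consecutive⇒rgt< : ∀ {A B} → Consecutive 𝔾 s A B → rgt A < rgt B
  consecutive⇒rgt< (mA , mB , lt , _) = lft<⇒rgt< mA mB lt

  consecutive-lft≤ˡ : ∀ {A B K} → Consecutive 𝔾 s A B → Maximal 𝔾 s K → lft K < lft B → lft K ≤ lft A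
  consecutive-lft≤ˡ {A} {B} {K} (_ , _ , _ , gap) mK lt = ≮⇒≥ λ A<K → gap K mK A<K lt

  consecutive-lft≤ʳ : ∀ {A B K} → Consecutive 𝔾 s A B → Maximal 𝔾 s K → lft A < lft K → lft B ≤ lft K
  consecutive-lft≤ʳ {A} {B} {K} (_ , _ , _ , gap) mK lt = ≮⇒≥ λ K<B → gap K mK lt K<B

  predecessor-unique : ∀ {A A' X} → Consecutive 𝔾 s A X → Consecutive 𝔾 s A' X → A ≡ A'
  predecessor-unique {A} {A'} (mA , _ , lt , gap) (mA' , _ , lt' , gap') with <-cmp (lft A) (lft A')
  ... | tri< p _ _ = ⊥-elim (gap A' mA' p lt')
  ... | tri≈ _ p _ = lft-injective mA mA' p
  ... | tri> _ _ p = ⊥-elim (gap' A mA p lt)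

  successor-unique : ∀ {X B B'} → Consecutive 𝔾 s X B → Consecutive 𝔾 s X B' → B ≡ B'
  successor-unique {X} {B} {B'} (_ , mB , lt , gap) (_ , mB' , lt' , gap') with <-cmp (lft B) (lft B')
  ... | tri< p _ _ = ⊥-elim (gap' B mB lt p)
  ... | tri≈ _ p _ = lft-injective mB mB' p
  ... | tri> _ _ p = ⊥-elim (gap B' mB' lt' p)

-- ↓s keeps the left endpoint of every maximal member of F|t, and ↓t the right endpoint of every
-- maximal member of F|s; consecutiveness of maximal members transfers along such correspondences.
module _ {𝔸 𝔹 : Fam} {v w : Interval} where
  private
    module A = Maximals 𝔸 v
    module B = Maximals 𝔹 w

  consecutive-transferˡ : (∀ {K} → Maximal 𝔹 w K → ∃ λ K' → Maximal 𝔸 v K' × lft K' ≡ lft K) →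
                          ∀ {A B A' B'} → Consecutive 𝔸 v A B → Maximal 𝔹 w A' → Maximal 𝔹 w B' →
                          lft A ≡ lft A' → lft B ≡ lft B' → Consecutive 𝔹 w A' B'
  consecutive-transferˡ back (_ , _ , A<B , gap) mA' mB' refl refl = mA' , mB' , A<B , λ K mK A<K K<B →
    let K' , mK' , K'≡K = back mK
    in gap K' mK' (subst (_ <_) (sym K'≡K) A<K) (subst (_< _) (sym K'≡K) K<B)

  consecutive-transferʳ : (∀ {K} → Maximal 𝔹 w K → ∃ λ K' → Maximal 𝔸 v K' × rgt K' ≡ rgt K) →
                          ∀ {A B A' B'} → Consecutive 𝔸 v A B → Maximal 𝔹 w A' → Maximal 𝔹 w B' →
                          rgt A ≡ rgt A' → rgt B ≡ rgt B' → Consecutive 𝔹 w A' B'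
  consecutive-transferʳ back c@(mA , mB , _ , gap) mA' mB' refl refl =
    mA' , mB' , B.rgt<⇒lft< mA' mB' (A.consecutive⇒rgt< c) , λ K mK A'<K K<B' →
      let K' , mK' , K'≡K = back mK
      in gap K' mK' (A.rgt<⇒lft< mA mK' (subst (_ <_) (sym K'≡K) (B.lft<⇒rgt< mA' mK A'<K)))
                    (A.rgt<⇒lft< mK' mB (subst (_< _) (sym K'≡K) (B.lft<⇒rgt< mK mB' K<B')))

-- What the argument uses about a minimal bad interval s of a finite family.
record IsMinimalBad (𝔽 : Fam) (s : Interval) : Set where
  field
    nonempty : IsInterval s
    members-nonempty : ∀ {I} → 𝔽 I → IsInterval I
    maximal-above : ∀ {K} → 𝔽 K → K ⊆ᵢ s → ∃ λ J → Maximal 𝔽 s J × K ⊆ᵢ J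
    predecessor : ∀ {X A} → Maximal 𝔽 s X → Maximal 𝔽 s A → lft A < lft X →
                  ∃ λ A' → Consecutive 𝔽 s A' X
    successor : ∀ {X B} → Maximal 𝔽 s X → Maximal 𝔽 s B → lft X < lft B →
                ∃ λ B' → Consecutive 𝔽 s X B'
    maximal? : ∀ J → Dec (Maximal 𝔽 s J)
    covered-twice : ∀ {x} → s ∋ x → CoveredTwice 𝔽 s x
    proper-good : ∀ {v} → IsInterval v → v ⊆ᵢ s → v ≢ s →
                  ¬ ¬ (∃ λ x → v ∋ x × CoveredAtMostOnce 𝔽 v x)

module MinimalBadInterval {𝔽 : Fam} {s : Interval} (H : IsMinimalBad 𝔽 s) where
  open IsMinimalBad H
  open Maximals 𝔽 s

  prefix : Interval → Interval
  prefix A = (lft s , rgt A)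

  covers-before-successor⇒⊆prefix : ∀ {A B C x} → Consecutive 𝔽 s A B → Covers 𝔽 s x C →
                                     x < lft B → C ⊆ᵢ prefix A
  covers-before-successor⇒⊆prefix c@(mA , _) (fC , sC , C∋x) x<B with maximal-above fC sC
  ... | J , mJ , (J≤C , C≤J) = proj₁ sC ,
    ≤-trans C≤J (lft≤⇒rgt≤ mJ mA (consecutive-lft≤ˡ c mJ (≤-<-trans J≤C (≤-<-trans (proj₁ C∋x) x<B))))

  private
    prefix⊆s : ∀ {A B} → Consecutive 𝔽 s A B → prefix A ⊆ᵢ s
    prefix⊆s ((_ , A⊆s , _) , _) = ≤-refl , proj₂ A⊆s

    prefix-nonempty : ∀ {A B} → Consecutive 𝔽 s A B → IsInterval (prefix A)
    prefix-nonempty ((fA , A⊆s , _) , _) = ≤-<-trans (proj₁ A⊆s) (members-nonempty fA)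

    prefix≢s : ∀ {A B} → Consecutive 𝔽 s A B → prefix A ≢ s
    prefix≢s c@(_ , (_ , B⊆s , _) , _) eq = <-irrefl (cong rgt eq) (<-≤-trans (consecutive⇒rgt< c) (proj₂ B⊆s))

  thin-point-of-prefix : ∀ {A B x} → Consecutive 𝔽 s A B → prefix A ∋ x →
                         CoveredAtMostOnce 𝔽 (prefix A) x → lft B ≤ x
  thin-point-of-prefix {A} {B} {x} c x∈prefix thin = ≮⇒≥ λ x<B →
    let C , D , C≢D , cC , cD = covered-twice (∋-⊆ᵢ x∈prefix (prefix⊆s c))
        shrink : ∀ {E} → Covers 𝔽 s x E → Covers 𝔽 (prefix A) x E
        shrink (fE , E⊆s , E∋x) = fE , covers-before-successor⇒⊆prefix c (fE , E⊆s , E∋x) x<B , E∋x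
    in C≢D (thin (shrink cC) (shrink cD))

  consecutive-overlap : ∀ {A B} → Consecutive 𝔽 s A B → lft B < rgt A
  consecutive-overlap c = decidable-stable (_ <? _) λ B≮A →
    proper-good (prefix-nonempty c) (prefix⊆s c) (prefix≢s c) λ (x , x∈prefix , thin) →
      B≮A (≤-<-trans (thin-point-of-prefix c x∈prefix thin) (proj₂ x∈prefix))

  overlap-∉ : ∀ {I} → Overlap 𝔽 s I → ¬ 𝔽 I
  overlap-∉ (A , B , c@((fA , A⊆s , _) , (_ , B⊆s , _) , A<B , _) , refl) fI =
    proper-good (prefix-nonempty c) (prefix⊆s c) (prefix≢s c) λ (x , x∈prefix , thin) →
      let B≤x = thin-point-of-prefix c x∈prefix thin
          A∋x = ≤-trans (<⇒≤ A<B) B≤x , proj₂ x∈prefix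
      in <-irrefl (cong lft (thin (fA , (proj₁ A⊆s , ≤-refl) , A∋x)
                                  (fI , (proj₁ B⊆s , ≤-refl) , (B≤x , proj₂ x∈prefix)))) A<B

module TwoMinimalBadIntervals {𝔽 : Fam} {s t : Interval} (Hs : IsMinimalBad 𝔽 s) (Ht : IsMinimalBad 𝔽 t)
                              (p<p' : lft s < lft t) where
  module Hs = IsMinimalBad Hs
  module Ht = IsMinimalBad Ht
  module Mˢ = Maximals 𝔽 s
  module Mᵗ = Maximals 𝔽 t
  open MinimalBadInterval Hs using ()
    renaming (consecutive-overlap to consecutive-overlapˢ; overlap-∉ to overlap-∉ˢ)
  open MinimalBadInterval Ht using ()
    renaming (consecutive-overlap to consecutive-overlapᵗ; overlap-∉ to overlap-∉ᵗ)

  q p' q' : ℤ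
  q = rgt s
  p' = lft t
  q' = rgt t

  q<q' : q < q'
  q<q' = decidable-stable (q <? q') λ q≮q' →
    Hs.proper-good Ht.nonempty (<⇒≤ p<p' , ≮⇒≥ q≮q') (λ eq → <-irrefl (sym (cong lft eq)) p<p')
      λ (x , t∋x , thin) → let C , D , C≢D , cC , cD = Ht.covered-twice t∋x in C≢D (thin cC cD)

  u : Interval
  u = (p' , q)

  u⊆s : u ⊆ᵢ s
  u⊆s = <⇒≤ p<p' , ≤-refl

  u⊆t : u ⊆ᵢ t
  u⊆t = ≤-refl , <⇒≤ q<q'

  Shared : Interval → Set
  Shared X = Maximal 𝔽 s X × Maximal 𝔽 t X

  shared⊆u : ∀ {X} → Shared X → X ⊆ᵢ u
  shared⊆u ((_ , X⊆s , _) , (_ , X⊆t , _)) = proj₁ X⊆t , proj₂ X⊆s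

  u-good : ∀ {X} → Shared X → ¬ ¬ (∃ λ x → u ∋ x × CoveredAtMostOnce 𝔽 u x)
  u-good sh@((fX , _) , _) = Hs.proper-good u-nonempty u⊆s (λ eq → <-irrefl (sym (cong lft eq)) p<p')
    where
    u-nonempty : IsInterval u
    u-nonempty = ≤-<-trans (proj₁ (shared⊆u sh)) (<-≤-trans (Hs.members-nonempty fX) (proj₂ (shared⊆u sh)))

  module _ {x : ℤ} (u∋x : u ∋ x) (thin : CoveredAtMostOnce 𝔽 u x) where

    left-cover : ∃ λ C → Covers 𝔽 s x C × lft C < p'
    left-cover with Hs.covered-twice (∋-⊆ᵢ u∋x u⊆s)
    ... | C , D , C≢D , cC , cD with lft C <? p' | lft D <? p'
    ... | yes C<p' | _ = C , cC , C<p'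
    ... | no _ | yes D<p' = D , cD , D<p'
    ... | no C≮p' | no D≮p' = ⊥-elim (C≢D (thin (in-u cC C≮p') (in-u cD D≮p')))
      where
      in-u : ∀ {E} → Covers 𝔽 s x E → ¬ lft E < p' → Covers 𝔽 u x E
      in-u (fE , E⊆s , E∋x) E≮p' = fE , (≮⇒≥ E≮p' , proj₂ E⊆s) , E∋x

    right-cover : ∃ λ B → Covers 𝔽 t x B × q < rgt B
    right-cover with Ht.covered-twice (∋-⊆ᵢ u∋x u⊆t)
    ... | C , D , C≢D , cC , cD with q <? rgt C | q <? rgt D
    ... | yes q<C | _ = C , cC , q<C
    ... | no _ | yes q<D = D , cD , q<D
    ... | no q≮C | no q≮D = ⊥-elim (C≢D (thin (in-u cC q≮C) (in-u cD q≮D)))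
      where
      in-u : ∀ {E} → Covers 𝔽 t x E → ¬ q < rgt E → Covers 𝔽 u x E
      in-u (fE , E⊆t , E∋x) q≮E = fE , (proj₁ E⊆t , ≮⇒≥ q≮E) , E∋x

    shared-covers : ∀ {X} → Shared X → Covers 𝔽 u x X
    shared-covers {X} sh@((fX , _ , maxˢ) , (_ , _ , maxᵗ)) = fX , shared⊆u sh , (X≤x , x<X)
      where
      X≤x : lft X ≤ x
      X≤x = ≮⇒≥ λ x<X →
        let B , (fB , B⊆t , B∋x) , q<B = right-cover
            J , (fJ , J⊆t , _) , (J≤B , B≤J) = Ht.maximal-above fB B⊆t
            J<X = ≤-<-trans J≤B (≤-<-trans (proj₁ B∋x) x<X)
        in maxᵗ J fJ J⊆t (⊆ᵢ∧lft<⇒⊂ᵢ (<⇒≤ J<X , ≤-trans (proj₂ (shared⊆u sh)) (≤-trans (<⇒≤ q<B) B≤J)) J<X)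
      x<X : x < rgt X
      x<X = decidable-stable (x <? rgt X) λ x≮X →
        let C , (fC , C⊆s , C∋x) , C<p' = left-cover
            J , (fJ , J⊆s , _) , (J≤C , C≤J) = Hs.maximal-above fC C⊆s
            J<X = ≤-<-trans J≤C (<-≤-trans C<p' (proj₁ (shared⊆u sh)))
        in maxˢ J fJ J⊆s (⊆ᵢ∧lft<⇒⊂ᵢ (<⇒≤ J<X , ≤-trans (≮⇒≥ x≮X) (<⇒≤ (<-≤-trans (proj₂ C∋x) C≤J))) J<X)

    <-rgt-predecessor : ∀ {X A} → Shared X → Consecutive 𝔽 s A X → x < rgt A
    <-rgt-predecessor sh c@(mA , _) =
      let C , (fC , C⊆s , C∋x) , C<p' = left-cover
          J , mJ , (J≤C , C≤J) = Hs.maximal-above fC C⊆s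
          J<X = ≤-<-trans J≤C (<-≤-trans C<p' (proj₁ (shared⊆u sh)))
      in <-≤-trans (proj₂ C∋x) (≤-trans C≤J (Mˢ.lft≤⇒rgt≤ mJ mA (Mˢ.consecutive-lft≤ˡ c mJ J<X)))

    lft-successor≤ : ∀ {X B} → Shared X → Consecutive 𝔽 t X B → lft B ≤ x
    lft-successor≤ sh@(_ , mX) c =
      let B₀ , (fB₀ , B₀⊆t , B₀∋x) , q<B₀ = right-cover
          J , mJ , (J≤B₀ , B₀≤J) = Ht.maximal-above fB₀ B₀⊆t
          X<J = Mᵗ.rgt<⇒lft< mX mJ (≤-<-trans (proj₂ (shared⊆u sh)) (<-≤-trans q<B₀ B₀≤J))
      in ≤-trans (Mᵗ.consecutive-lft≤ʳ c mJ X<J) (≤-trans J≤B₀ (proj₁ B₀∋x))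

  shared-unique : ∀ {X Y} → Shared X → Shared Y → X ≡ Y
  shared-unique shX shY = decidable-stable (_ ≟ᵢ _) λ X≢Y →
    u-good shX λ (x , u∋x , thin) → X≢Y (thin (shared-covers u∋x thin shX) (shared-covers u∋x thin shY))

  shared-predecessor : ∀ {X} → Shared X → ∃ λ A → Consecutive 𝔽 s A X
  shared-predecessor sh@(mX , _) =
    let C , _ , _ , (fC , C⊆s , C∋p) , _ = Hs.covered-twice (≤-refl , Hs.nonempty)
        J , mJ , (J≤C , _) = Hs.maximal-above fC C⊆s
    in Hs.predecessor mX mJ (≤-<-trans J≤C (≤-<-trans (proj₁ C∋p) (<-≤-trans p<p' (proj₁ (shared⊆u sh)))))

  shared-successor : ∀ {X} → Shared X → ∃ λ B → Consecutive 𝔽 t X B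
  shared-successor sh@((fX , _) , mX) =
    let X⊆u = shared⊆u sh
        t∋q = ≤-trans (proj₁ X⊆u) (<⇒≤ (<-≤-trans (Hs.members-nonempty fX) (proj₂ X⊆u))) , q<q'
        C , _ , _ , (fC , C⊆t , C∋q) , _ = Ht.covered-twice t∋q
        J , mJ , (_ , C≤J) = Ht.maximal-above fC C⊆t
    in Ht.successor mX mJ (Mᵗ.rgt<⇒lft< mX mJ (≤-<-trans (proj₂ X⊆u) (<-≤-trans (proj₂ C∋q) C≤J)))

  𝔾 ℍ : Fam
  𝔾 = Down 𝔽 s
  ℍ = Down 𝔽 t

  SharedOverlapˢ : Interval → Set
  SharedOverlapˢ J = ∃₂ λ X A → Maximal 𝔽 t X × Consecutive 𝔽 s A X × J ≡ (lft X , rgt A)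

  ↓s-maximalᵗ-kept : ∀ {J} → Maximal 𝔽 t J → ¬ Maximal 𝔽 s J → Maximal 𝔾 t J
  ↓s-maximalᵗ-kept (fJ , J⊆t , maxJ) ¬maxˢ = inj₁ (fJ , ¬maxˢ) , J⊆t , not-below
    where
    not-below : ∀ L → 𝔾 L → L ⊆ᵢ t → ¬ _ ⊂ᵢ L
    not-below L (inj₁ (fL , _)) L⊆t J⊂L = maxJ L fL L⊆t J⊂L
    not-below _ (inj₂ (A , B , c@(_ , (fB , B⊆s , _) , _) , refl)) L⊆t J⊂L =
      maxJ B fB (proj₁ L⊆t , ≤-trans (proj₂ B⊆s) (<⇒≤ q<q'))
        (⊂ᵢ-⊆ᵢ-trans J⊂L (≤-refl , <⇒≤ (Mˢ.consecutive⇒rgt< c)))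

  ↓s-maximalᵗ-overlap : ∀ {X A} → Maximal 𝔽 t X → Consecutive 𝔽 s A X → Maximal 𝔾 t (lft X , rgt A)
  ↓s-maximalᵗ-overlap {X} {A} mX@(_ , X⊆t , maxᵗ) c@(mA , mXs@(fX , _) , _) =
    inj₂ (A , X , c , refl) , (proj₁ X⊆t , ≤-trans (<⇒≤ (Mˢ.consecutive⇒rgt< c)) (proj₂ X⊆t)) , not-below
    where
    sh : Shared X
    sh = mXs , mX
    not-below : ∀ L → 𝔾 L → L ⊆ᵢ t → ¬ (lft X , rgt A) ⊂ᵢ L
    not-below _ (inj₂ (A' , B' , c'@(mA' , mB' , A'<B' , _) , refl)) _ ((B'≤X , A≤A') , P≢L) =
      P≢L (cong₂ _,_ (sym (cong lft B'≡X)) (sym (cong rgt (Mˢ.predecessor-unique c'' c))))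
      where
      X≤B' : lft X ≤ lft B'
      X≤B' = ≮⇒≥ λ B'<X → <-irrefl refl
        (<-≤-trans (Mˢ.lft<⇒rgt< mA' mA (<-≤-trans A'<B' (Mˢ.consecutive-lft≤ˡ c mB' B'<X))) A≤A')
      B'≡X : B' ≡ X
      B'≡X = Mˢ.lft-injective mB' mXs (≤-antisym B'≤X X≤B')
      c'' : Consecutive 𝔽 s A' X
      c'' = subst (Consecutive 𝔽 s A') B'≡X c'
    not-below L (inj₁ (fL , ¬maxˢL)) L⊆t ((L≤X , A≤L) , _) = u-good sh λ (x , u∋x , thin) →
      let cX@(_ , _ , X∋x) = shared-covers u∋x thin sh
          L∋x = ∋-⊆ᵢ (proj₁ X∋x , <-rgt-predecessor u∋x thin sh c) (L≤X , A≤L)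
      in case rgt L ≤? q of λ where
        (yes L≤q) → ¬maxˢL (subst (Maximal 𝔽 s) (thin cX (fL , (proj₁ L⊆t , L≤q) , L∋x)) mXs)
        (no L≰q) → maxᵗ L fL L⊆t
          (⊆ᵢ∧rgt<⇒⊂ᵢ (L≤X , ≤-trans (proj₂ (shared⊆u sh)) (<⇒≤ (≰⇒> L≰q)))
                      (≤-<-trans (proj₂ (shared⊆u sh)) (≰⇒> L≰q)))

  ↓s-maximalᵗ-not-below-shared : ∀ {J X} → Maximal 𝔾 t J → 𝔽 J → ¬ Maximal 𝔽 s J → Shared X → J ⊂ᵢ X → ⊥
  ↓s-maximalᵗ-not-below-shared {J} {X} (_ , _ , maxJ) fJ ¬maxˢ sh@(mXs , mX) J⊂X =
    u-good sh λ (x , u∋x , thin) → locate u∋x thin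
    where
    J⊆u : J ⊆ᵢ u
    J⊆u = ⊆ᵢ-trans (proj₁ J⊂X) (shared⊆u sh)
    locate : ∀ {x} → u ∋ x → CoveredAtMostOnce 𝔽 u x → ⊥
    locate {x} u∋x thin with x <? lft J | rgt J ≤? x
    ... | yes x<J | _ =
      let B₀ , (fB₀ , B₀⊆t , B₀∋x) , q<B₀ = right-cover u∋x thin
          K , mK@(fK , K⊆t , _) , (K≤B₀ , B₀≤K) = Ht.maximal-above fB₀ B₀⊆t
          q<K = <-≤-trans q<B₀ B₀≤K
          K<J = ≤-<-trans K≤B₀ (≤-<-trans (proj₁ B₀∋x) x<J)
      in maxJ K (proj₁ (↓s-maximalᵗ-kept mK λ (_ , K⊆s , _) → <-irrefl refl (<-≤-trans q<K (proj₂ K⊆s))))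
           K⊆t (⊆ᵢ∧lft<⇒⊂ᵢ (<⇒≤ K<J , ≤-trans (proj₂ J⊆u) (<⇒≤ q<K)) K<J)
    ... | no _ | yes J≤x =
      let A , c = shared-predecessor sh
          mP@(_ , P⊆t , _) = ↓s-maximalᵗ-overlap mX c
      in maxJ _ (proj₁ mP) P⊆t ((proj₁ (proj₁ J⊂X) , ≤-trans J≤x (<⇒≤ (<-rgt-predecessor u∋x thin sh c))) ,
                               λ { refl → overlap-∉ˢ (A , X , c , refl) fJ })
    ... | no x≮J | no J≰x =
      ¬maxˢ (subst (Maximal 𝔽 s) (thin (shared-covers u∋x thin sh) (fJ , J⊆u , (≮⇒≥ x≮J , ≰⇒> J≰x))) mXs)

  ↓s-maximalᵗ-cases : ∀ {J} → Maximal 𝔾 t J → (Maximal 𝔽 t J × ¬ Maximal 𝔽 s J) ⊎ SharedOverlapˢ J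
  ↓s-maximalᵗ-cases {J} mJ@(inj₁ (fJ , ¬maxˢ) , J⊆t , maxJ) = inj₁ ((fJ , J⊆t , maxᵗ) , ¬maxˢ)
    where
    maxᵗ : ∀ L → 𝔽 L → L ⊆ᵢ t → ¬ J ⊂ᵢ L
    maxᵗ L fL L⊆t J⊂L with Ht.maximal-above fL L⊆t
    ... | K , mK , L⊆K with Hs.maximal? K
    ... | no ¬mKs = maxJ K (proj₁ (↓s-maximalᵗ-kept mK ¬mKs)) (proj₁ (proj₂ mK)) (⊂ᵢ-⊆ᵢ-trans J⊂L L⊆K)
    ... | yes mKs = ↓s-maximalᵗ-not-below-shared mJ fJ ¬maxˢ (mKs , mK) (⊂ᵢ-⊆ᵢ-trans J⊂L L⊆K)
  ↓s-maximalᵗ-cases (inj₂ (A , B , c@(_ , (fB , B⊆s , maxBs) , _) , refl) , J⊆t , maxJ)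
    with Ht.maximal-above fB (proj₁ J⊆t , ≤-trans (proj₂ B⊆s) (<⇒≤ q<q'))
  ... | K , mK@(fK , K⊆t , _) , B⊆K with Hs.maximal? K
  ... | no ¬mKs = ⊥-elim (maxJ K (inj₁ (fK , ¬mKs)) K⊆t
        (⊆ᵢ-trans (≤-refl , <⇒≤ (Mˢ.consecutive⇒rgt< c)) B⊆K , λ { refl → overlap-∉ˢ (A , B , c , refl) fK }))
  ... | yes (fK' , K⊆s , _) = inj₂ (B , A , subst (Maximal 𝔽 t) K≡B mK , c , refl)
    where
    K≡B : K ≡ B
    K≡B = decidable-stable (K ≟ᵢ B) λ K≢B → maxBs K fK' K⊆s (B⊆K , λ e → K≢B (sym e))

  lft-↓s-maximalᵗ : ∀ {K} → Maximal 𝔽 t K → ∃ λ K' → Maximal 𝔾 t K' × lft K' ≡ lft K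
  lft-↓s-maximalᵗ {K} mK with Hs.maximal? K
  ... | no ¬mKs = K , ↓s-maximalᵗ-kept mK ¬mKs , refl
  ... | yes mKs = let A , c = shared-predecessor (mKs , mK) in _ , ↓s-maximalᵗ-overlap mK c , refl

  lft-maximalᵗ : ∀ {K} → Maximal 𝔾 t K → ∃ λ K' → Maximal 𝔽 t K' × lft K' ≡ lft K
  lft-maximalᵗ mK with ↓s-maximalᵗ-cases mK
  ... | inj₁ (mK' , _) = _ , mK' , refl
  ... | inj₂ (X , _ , mX , _ , refl) = X , mX , refl

  ↓s-consecutiveᵗ⁻ : ∀ {A' B' A B} → Consecutive 𝔾 t A' B' → Maximal 𝔽 t A → Maximal 𝔽 t B →
                     lft A' ≡ lft A → lft B' ≡ lft B → Consecutive 𝔽 t A B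
  ↓s-consecutiveᵗ⁻ = consecutive-transferˡ lft-↓s-maximalᵗ

  ↓s-consecutiveᵗ⁺ : ∀ {A B A' B'} → Consecutive 𝔽 t A B → Maximal 𝔾 t A' → Maximal 𝔾 t B' →
                     lft A ≡ lft A' → lft B ≡ lft B' → Consecutive 𝔾 t A' B'
  ↓s-consecutiveᵗ⁺ = consecutive-transferˡ lft-maximalᵗ

  ↓s-consecutiveᵗ-overlap : ∀ {A' B'} → Consecutive 𝔾 t A' B' → lft B' < rgt A'
  ↓s-consecutiveᵗ-overlap c@(mA' , mB' , A'<B' , _) with ↓s-maximalᵗ-cases mA' | ↓s-maximalᵗ-cases mB'
  ... | inj₁ (mA , _) | inj₁ (mB , _) = consecutive-overlapᵗ (↓s-consecutiveᵗ⁻ c mA mB refl refl)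
  ... | inj₂ (X , A , mX , cˢ , refl) | inj₁ (mB , _) =
    let sh = proj₁ (proj₂ cˢ) , mX
        cᵗ = ↓s-consecutiveᵗ⁻ c mX mB refl refl
    in decidable-stable (_ <? _) λ B≮A → u-good sh λ (x , u∋x , thin) →
         B≮A (≤-<-trans (lft-successor≤ u∋x thin sh cᵗ) (<-rgt-predecessor u∋x thin sh cˢ))
  ... | inj₁ (mA , _) | inj₂ (X , _ , mX , _ , refl) =
    consecutive-overlapᵗ (↓s-consecutiveᵗ⁻ c mA mX refl refl)
  ... | inj₂ (X , _ , mX , cX , refl) | inj₂ (Y , _ , mY , cY , refl) =
    ⊥-elim (<-irrefl (cong lft (shared-unique (proj₁ (proj₂ cX) , mX) (proj₁ (proj₂ cY) , mY))) A'<B')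

  SharedOverlapᵗ : Interval → Set
  SharedOverlapᵗ J = ∃₂ λ X B → Maximal 𝔽 s X × Consecutive 𝔽 t X B × J ≡ (lft B , rgt X)

  ↓t-maximalˢ-kept : ∀ {J} → Maximal 𝔽 s J → ¬ Maximal 𝔽 t J → Maximal ℍ s J
  ↓t-maximalˢ-kept (fJ , J⊆s , maxJ) ¬maxᵗ = inj₁ (fJ , ¬maxᵗ) , J⊆s , not-below
    where
    not-below : ∀ L → ℍ L → L ⊆ᵢ s → ¬ _ ⊂ᵢ L
    not-below L (inj₁ (fL , _)) L⊆s J⊂L = maxJ L fL L⊆s J⊂L
    not-below _ (inj₂ (A , B , ((fA , A⊆t , _) , _ , A<B , _) , refl)) L⊆s J⊂L =
      maxJ A fA (≤-trans (<⇒≤ p<p') (proj₁ A⊆t) , proj₂ L⊆s) (⊂ᵢ-⊆ᵢ-trans J⊂L (<⇒≤ A<B , ≤-refl))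

  ↓t-maximalˢ-overlap : ∀ {X B} → Maximal 𝔽 s X → Consecutive 𝔽 t X B → Maximal ℍ s (lft B , rgt X)
  ↓t-maximalˢ-overlap {X} {B} mX@(fX , X⊆s , maxˢ) c@(mXt@(_ , X⊆t , _) , _ , X<B , _) =
    inj₂ (X , B , c , refl) , (≤-trans (<⇒≤ p<p') (≤-trans (proj₁ X⊆t) (<⇒≤ X<B)) , proj₂ X⊆s) , not-below
    where
    sh : Shared X
    sh = mX , mXt
    not-below : ∀ L → ℍ L → L ⊆ᵢ s → ¬ (lft B , rgt X) ⊂ᵢ L
    not-below _ (inj₂ (A' , B' , c'@(mA' , _ , A'<B' , _) , refl)) _ ((B'≤B , rX≤rA') , Q≢L) =
      Q≢L (cong₂ _,_ (sym (cong lft (Mᵗ.successor-unique c'' c))) (sym (cong rgt A'≡X)))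
      where
      A'≤X : lft A' ≤ lft X
      A'≤X = ≮⇒≥ λ X<A' → <-irrefl refl (≤-<-trans (Mᵗ.consecutive-lft≤ʳ c mA' X<A') (<-≤-trans A'<B' B'≤B))
      X≤A' : lft X ≤ lft A'
      X≤A' = ≮⇒≥ λ A'<X → <-irrefl refl (<-≤-trans (Mᵗ.lft<⇒rgt< mA' mXt A'<X) rX≤rA')
      A'≡X : A' ≡ X
      A'≡X = Mᵗ.lft-injective mA' mXt (≤-antisym A'≤X X≤A')
      c'' : Consecutive 𝔽 t X B'
      c'' = subst (λ Z → Consecutive 𝔽 t Z B') A'≡X c'
    not-below L (inj₁ (fL , ¬maxᵗL)) L⊆s ((L≤B , X≤L) , _) = u-good sh λ (x , u∋x , thin) →
      let cX@(_ , _ , X∋x) = shared-covers u∋x thin sh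
          L∋x = ∋-⊆ᵢ (lft-successor≤ u∋x thin sh c , proj₂ X∋x) (L≤B , X≤L)
      in case p' ≤? lft L of λ where
        (yes p'≤L) → ¬maxᵗL (subst (Maximal 𝔽 t) (thin cX (fL , (p'≤L , proj₂ L⊆s) , L∋x)) mXt)
        (no p'≰L) → maxˢ L fL L⊆s
          (⊆ᵢ∧lft<⇒⊂ᵢ (≤-trans (<⇒≤ (≰⇒> p'≰L)) (proj₁ (shared⊆u sh)) , X≤L)
                      (<-≤-trans (≰⇒> p'≰L) (proj₁ (shared⊆u sh))))

  ↓t-maximalˢ-not-below-shared : ∀ {J X} → Maximal ℍ s J → 𝔽 J → ¬ Maximal 𝔽 t J → Shared X → J ⊂ᵢ X → ⊥
  ↓t-maximalˢ-not-below-shared {J} {X} (_ , _ , maxJ) fJ ¬maxᵗ sh@(mX , mXt) J⊂X =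
    u-good sh λ (x , u∋x , thin) → locate u∋x thin
    where
    J⊆u : J ⊆ᵢ u
    J⊆u = ⊆ᵢ-trans (proj₁ J⊂X) (shared⊆u sh)
    locate : ∀ {x} → u ∋ x → CoveredAtMostOnce 𝔽 u x → ⊥
    locate {x} u∋x thin with x <? lft J | rgt J ≤? x
    ... | yes x<J | _ =
      let B , c = shared-successor sh
          mQ@(_ , Q⊆s , _) = ↓t-maximalˢ-overlap mX c
      in maxJ _ (proj₁ mQ) Q⊆s ((≤-trans (lft-successor≤ u∋x thin sh c) (<⇒≤ x<J) , proj₂ (proj₁ J⊂X)) ,
                               λ { refl → overlap-∉ᵗ (X , B , c , refl) fJ })
    ... | no _ | yes J≤x =
      let C , (fC , C⊆s , C∋x) , C<p' = left-cover u∋x thin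
          K , mK@(fK , K⊆s , _) , (K≤C , C≤K) = Hs.maximal-above fC C⊆s
          K<p' = ≤-<-trans K≤C C<p'
          K<J = <-≤-trans K<p' (proj₁ J⊆u)
      in maxJ K (proj₁ (↓t-maximalˢ-kept mK λ (_ , K⊆t , _) → <-irrefl refl (<-≤-trans K<p' (proj₁ K⊆t))))
           K⊆s (⊆ᵢ∧lft<⇒⊂ᵢ (<⇒≤ K<J , ≤-trans J≤x (<⇒≤ (<-≤-trans (proj₂ C∋x) C≤K))) K<J)
    ... | no x≮J | no J≰x =
      ¬maxᵗ (subst (Maximal 𝔽 t) (thin (shared-covers u∋x thin sh) (fJ , J⊆u , (≮⇒≥ x≮J , ≰⇒> J≰x))) mXt)

  ↓t-maximalˢ-cases : ∀ {J} → Maximal ℍ s J → (Maximal 𝔽 s J × ¬ Maximal 𝔽 t J) ⊎ SharedOverlapᵗ J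
  ↓t-maximalˢ-cases {J} mJ@(inj₁ (fJ , ¬maxᵗ) , J⊆s , maxJ) = inj₁ ((fJ , J⊆s , maxˢ) , ¬maxᵗ)
    where
    maxˢ : ∀ L → 𝔽 L → L ⊆ᵢ s → ¬ J ⊂ᵢ L
    maxˢ L fL L⊆s J⊂L with Hs.maximal-above fL L⊆s
    ... | K , mK , L⊆K with Ht.maximal? K
    ... | no ¬mKt = maxJ K (proj₁ (↓t-maximalˢ-kept mK ¬mKt)) (proj₁ (proj₂ mK)) (⊂ᵢ-⊆ᵢ-trans J⊂L L⊆K)
    ... | yes mKt = ↓t-maximalˢ-not-below-shared mJ fJ ¬maxᵗ (mK , mKt) (⊂ᵢ-⊆ᵢ-trans J⊂L L⊆K)
  ↓t-maximalˢ-cases (inj₂ (A , B , c@((fA , A⊆t , maxAt) , _ , A<B , _) , refl) , J⊆s , maxJ)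
    with Hs.maximal-above fA (≤-trans (<⇒≤ p<p') (proj₁ A⊆t) , proj₂ J⊆s)
  ... | K , mK@(fK , K⊆s , _) , A⊆K with Ht.maximal? K
  ... | no ¬mKt = ⊥-elim (maxJ K (inj₁ (fK , ¬mKt)) K⊆s
        (⊆ᵢ-trans (<⇒≤ A<B , ≤-refl) A⊆K , λ { refl → overlap-∉ᵗ (A , B , c , refl) fK }))
  ... | yes (fK' , K⊆t , _) = inj₂ (A , B , subst (Maximal 𝔽 s) K≡A mK , c , refl)
    where
    K≡A : K ≡ A
    K≡A = decidable-stable (K ≟ᵢ A) λ K≢A → maxAt K fK' K⊆t (A⊆K , λ e → K≢A (sym e))

  rgt-↓t-maximalˢ : ∀ {K} → Maximal 𝔽 s K → ∃ λ K' → Maximal ℍ s K' × rgt K' ≡ rgt K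
  rgt-↓t-maximalˢ {K} mK with Ht.maximal? K
  ... | no ¬mKt = K , ↓t-maximalˢ-kept mK ¬mKt , refl
  ... | yes mKt = let B , c = shared-successor (mK , mKt) in _ , ↓t-maximalˢ-overlap mK c , refl

  rgt-maximalˢ : ∀ {K} → Maximal ℍ s K → ∃ λ K' → Maximal 𝔽 s K' × rgt K' ≡ rgt K
  rgt-maximalˢ mK with ↓t-maximalˢ-cases mK
  ... | inj₁ (mK' , _) = _ , mK' , refl
  ... | inj₂ (X , _ , mX , _ , refl) = X , mX , refl

  ↓t-consecutiveˢ⁻ : ∀ {A' B' A B} → Consecutive ℍ s A' B' → Maximal 𝔽 s A → Maximal 𝔽 s B →
                     rgt A' ≡ rgt A → rgt B' ≡ rgt B → Consecutive 𝔽 s A B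
  ↓t-consecutiveˢ⁻ = consecutive-transferʳ rgt-↓t-maximalˢ

  ↓t-consecutiveˢ⁺ : ∀ {A B A' B'} → Consecutive 𝔽 s A B → Maximal ℍ s A' → Maximal ℍ s B' →
                     rgt A ≡ rgt A' → rgt B ≡ rgt B' → Consecutive ℍ s A' B'
  ↓t-consecutiveˢ⁺ = consecutive-transferʳ rgt-maximalˢ

  ↓t-consecutiveˢ-overlap : ∀ {A' B'} → Consecutive ℍ s A' B' → lft B' < rgt A'
  ↓t-consecutiveˢ-overlap c@(mA' , mB' , _ , _) with ↓t-maximalˢ-cases mA' | ↓t-maximalˢ-cases mB'
  ... | inj₁ (mA , _) | inj₁ (mB , _) = consecutive-overlapˢ (↓t-consecutiveˢ⁻ c mA mB refl refl)
  ... | inj₁ (mA , _) | inj₂ (X , B , mX , cᵗ , refl) =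
    let sh = mX , proj₁ cᵗ
        cˢ = ↓t-consecutiveˢ⁻ c mA mX refl refl
    in decidable-stable (_ <? _) λ B≮A → u-good sh λ (x , u∋x , thin) →
         B≮A (≤-<-trans (lft-successor≤ u∋x thin sh cᵗ) (<-rgt-predecessor u∋x thin sh cˢ))
  ... | inj₂ (X , _ , mX , _ , refl) | inj₁ (mB , _) =
    consecutive-overlapˢ (↓t-consecutiveˢ⁻ c mX mB refl refl)
  ... | inj₂ (X , _ , mX , cX , refl) | inj₂ (Y , _ , mY , cY , refl) =
    ⊥-elim (<-irrefl (cong rgt (shared-unique (mX , proj₁ cX) (mY , proj₁ cY)))
                     (Maximals.consecutive⇒rgt< ℍ s c))

  OuterOverlap : Interval → Set
  OuterOverlap I = ∃₂ λ X A → ∃ λ B → Consecutive 𝔽 s A X × Consecutive 𝔽 t X B × I ≡ (lft B , rgt A)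

  Common : Fam
  Common I = (𝔽 I × ¬ Maximal 𝔽 s I × ¬ Maximal 𝔽 t I)
           ⊎ (Overlap 𝔽 s I × ¬ SharedOverlapˢ I)
           ⊎ (Overlap 𝔽 t I × ¬ SharedOverlapᵗ I)
           ⊎ OuterOverlap I

  ↓s↓t⇒common : ∀ {I} → Down 𝔾 t I → Common I
  ↓s↓t⇒common (inj₁ (inj₁ (fI , ¬maxˢ) , ¬maxᵍ)) =
    inj₁ (fI , ¬maxˢ , λ maxᵗ → ¬maxᵍ (↓s-maximalᵗ-kept maxᵗ ¬maxˢ))
  ↓s↓t⇒common (inj₁ (inj₂ ov , ¬maxᵍ)) =
    inj₂ (inj₁ (ov , λ { (X , A , mX , c , refl) → ¬maxᵍ (↓s-maximalᵗ-overlap mX c) }))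
  ↓s↓t⇒common (inj₂ (A' , B' , c@(mA' , mB' , A'<B' , _) , refl))
    with ↓s-maximalᵗ-cases mA' | ↓s-maximalᵗ-cases mB'
  ... | inj₁ (mA , ¬mAˢ) | inj₁ (mB , _) =
    inj₂ (inj₂ (inj₁ ((A' , B' , ↓s-consecutiveᵗ⁻ c mA mB refl refl , refl) ,
      λ (X , _ , mX , cᵗ , eq) →
        ¬mAˢ (subst (Maximal 𝔽 s) (Mᵗ.rgt-injective (proj₁ cᵗ) mA (sym (cong rgt eq))) mX))))
  ... | inj₂ (X , A , mX , cˢ , refl) | inj₁ (mB , _) =
    inj₂ (inj₂ (inj₂ (X , A , B' , cˢ , ↓s-consecutiveᵗ⁻ c mX mB refl refl , refl)))
  ... | inj₁ (mA , _) | inj₂ (X , _ , mX , cX , refl) =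
    inj₂ (inj₂ (inj₁ ((A' , X , ↓s-consecutiveᵗ⁻ c mA mX refl refl , refl) ,
      λ (Y , B , mY , cY@(_ , _ , Y<B , _) , eq) →
        <-irrefl (trans (cong lft (shared-unique (mY , proj₁ cY) (proj₁ (proj₂ cX) , mX))) (cong lft eq)) Y<B)))
  ... | inj₂ (X , _ , mX , cX , refl) | inj₂ (Y , _ , mY , cY , refl) =
    ⊥-elim (<-irrefl (cong lft (shared-unique (proj₁ (proj₂ cX) , mX) (proj₁ (proj₂ cY) , mY))) A'<B')

  common⇒↓s↓t : ∀ {I} → Common I → Down 𝔾 t I
  common⇒↓s↓t (inj₁ (fI , ¬maxˢ , ¬maxᵗ)) =
    inj₁ (inj₁ (fI , ¬maxˢ) , λ mI → case ↓s-maximalᵗ-cases mI of λ where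
    (inj₁ (maxᵗ , _)) → ¬maxᵗ maxᵗ
    (inj₂ (X , A , _ , c , eq)) → overlap-∉ˢ (A , X , c , eq) fI)
  common⇒↓s↓t (inj₂ (inj₁ (ov , ¬so))) = inj₁ (inj₂ ov , λ mI → case ↓s-maximalᵗ-cases mI of λ where
    (inj₁ (maxᵗ , _)) → overlap-∉ˢ ov (proj₁ maxᵗ)
    (inj₂ so) → ¬so so)
  common⇒↓s↓t (inj₂ (inj₂ (inj₁ ((A , B , c@(mA , mB , _) , refl) , ¬so)))) with Hs.maximal? A | Hs.maximal? B
  ... | yes mAˢ | _ = ⊥-elim (¬so (A , B , mAˢ , c , refl))
  ... | no ¬mAˢ | no ¬mBˢ =
    inj₂ (A , B , ↓s-consecutiveᵗ⁺ c (↓s-maximalᵗ-kept mA ¬mAˢ) (↓s-maximalᵗ-kept mB ¬mBˢ) refl refl , refl)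
  ... | no ¬mAˢ | yes mBˢ =
    let A₀ , cˢ = shared-predecessor (mBˢ , mB)
    in inj₂ (A , _ , ↓s-consecutiveᵗ⁺ c (↓s-maximalᵗ-kept mA ¬mAˢ) (↓s-maximalᵗ-overlap mB cˢ) refl refl , refl)
  common⇒↓s↓t (inj₂ (inj₂ (inj₂ (X , A , B , cˢ , cᵗ@(mX , mB , X<B , _) , refl)))) with Hs.maximal? B
  ... | yes mBˢ = ⊥-elim (<-irrefl (cong lft (shared-unique (proj₁ (proj₂ cˢ) , mX) (mBˢ , mB))) X<B)
  ... | no ¬mBˢ =
    inj₂ (_ , B , ↓s-consecutiveᵗ⁺ cᵗ (↓s-maximalᵗ-overlap mX cˢ) (↓s-maximalᵗ-kept mB ¬mBˢ) refl refl , refl)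

  ↓t↓s⇒common : ∀ {I} → Down ℍ s I → Common I
  ↓t↓s⇒common (inj₁ (inj₁ (fI , ¬maxᵗ) , ¬maxʰ)) =
    inj₁ (fI , (λ maxˢ → ¬maxʰ (↓t-maximalˢ-kept maxˢ ¬maxᵗ)) , ¬maxᵗ)
  ↓t↓s⇒common (inj₁ (inj₂ ov , ¬maxʰ)) =
    inj₂ (inj₂ (inj₁ (ov , λ { (X , B , mX , c , refl) → ¬maxʰ (↓t-maximalˢ-overlap mX c) })))
  ↓t↓s⇒common (inj₂ (A' , B' , c@(mA' , mB' , _) , refl))
    with ↓t-maximalˢ-cases mA' | ↓t-maximalˢ-cases mB'
  ... | inj₁ (mA , _) | inj₁ (mB , ¬mBᵗ) =
    inj₂ (inj₁ ((A' , B' , ↓t-consecutiveˢ⁻ c mA mB refl refl , refl) ,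
      λ (X , _ , mX , cˢ , eq) →
        ¬mBᵗ (subst (Maximal 𝔽 t) (Mˢ.lft-injective (proj₁ (proj₂ cˢ)) mB (sym (cong lft eq))) mX)))
  ... | inj₁ (mA , _) | inj₂ (X , B , mX , cᵗ , refl) =
    inj₂ (inj₂ (inj₂ (X , A' , B , ↓t-consecutiveˢ⁻ c mA mX refl refl , cᵗ , refl)))
  ... | inj₂ (X , _ , mX , cX , refl) | inj₁ (mB , _) =
    inj₂ (inj₁ ((X , B' , ↓t-consecutiveˢ⁻ c mX mB refl refl , refl) ,
      λ (Y , A , mY , cY , eq) →
        <-irrefl (trans (sym (cong rgt eq)) (cong rgt (shared-unique (mX , proj₁ cX) (proj₁ (proj₂ cY) , mY))))
                 (Mˢ.consecutive⇒rgt< cY)))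
  ... | inj₂ (X , _ , mX , cX , refl) | inj₂ (Y , _ , mY , cY , refl) =
    ⊥-elim (<-irrefl (cong rgt (shared-unique (mX , proj₁ cX) (mY , proj₁ cY)))
                     (Maximals.consecutive⇒rgt< ℍ s c))

  common⇒↓t↓s : ∀ {I} → Common I → Down ℍ s I
  common⇒↓t↓s (inj₁ (fI , ¬maxˢ , ¬maxᵗ)) =
    inj₁ (inj₁ (fI , ¬maxᵗ) , λ mI → case ↓t-maximalˢ-cases mI of λ where
    (inj₁ (maxˢ , _)) → ¬maxˢ maxˢ
    (inj₂ (X , B , _ , c , eq)) → overlap-∉ᵗ (X , B , c , eq) fI)
  common⇒↓t↓s (inj₂ (inj₂ (inj₁ (ov , ¬so)))) = inj₁ (inj₂ ov , λ mI → case ↓t-maximalˢ-cases mI of λ where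
    (inj₁ (maxˢ , _)) → overlap-∉ᵗ ov (proj₁ maxˢ)
    (inj₂ so) → ¬so so)
  common⇒↓t↓s (inj₂ (inj₁ ((A , B , c@(mA , mB , _) , refl) , ¬so))) with Ht.maximal? B | Ht.maximal? A
  ... | yes mBᵗ | _ = ⊥-elim (¬so (B , A , mBᵗ , c , refl))
  ... | no ¬mBᵗ | no ¬mAᵗ =
    inj₂ (A , B , ↓t-consecutiveˢ⁺ c (↓t-maximalˢ-kept mA ¬mAᵗ) (↓t-maximalˢ-kept mB ¬mBᵗ) refl refl , refl)
  ... | no ¬mBᵗ | yes mAᵗ =
    let B₀ , cᵗ = shared-successor (mA , mAᵗ)
    in inj₂ (_ , B , ↓t-consecutiveˢ⁺ c (↓t-maximalˢ-overlap mA cᵗ) (↓t-maximalˢ-kept mB ¬mBᵗ) refl refl , refl)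
  common⇒↓t↓s (inj₂ (inj₂ (inj₂ (X , A , B , cˢ@(mA , mX , A<X , _) , cᵗ , refl)))) with Ht.maximal? A
  ... | yes mAᵗ = ⊥-elim (<-irrefl (cong lft (shared-unique (mA , mAᵗ) (mX , proj₁ cᵗ))) A<X)
  ... | no ¬mAᵗ =
    inj₂ (A , _ , ↓t-consecutiveˢ⁺ cˢ (↓t-maximalˢ-kept mA ¬mAᵗ) (↓t-maximalˢ-overlap mX cᵗ) refl refl , refl)

module SortedBy {A : Set} (key : A → ℤ) where

  _≺_ : A → A → Set
  _≺_ = _<_ on key

  Adjacent : List A → A → A → Set
  Adjacent L a b = a ∈ L × b ∈ L × a ≺ b × (∀ k → k ∈ L → a ≺ k → k ≺ b → ⊥)

  ∈-consecutive⁻ : ∀ {L a b} → AllPairs _≺_ L → (a , b) ∈ consecutive L → Adjacent L a b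
  ∈-consecutive⁻ {x ∷ y ∷ ys} ((x≺y ∷ _) ∷ (y≺ys ∷ _)) (here refl) = here refl , there (here refl) , x≺y , gap
    where
    gap : ∀ k → k ∈ x ∷ y ∷ ys → x ≺ k → k ≺ y → ⊥
    gap _ (here refl) x≺x _ = <-irrefl refl x≺x
    gap _ (there (here refl)) _ y≺y = <-irrefl refl y≺y
    gap _ (there (there k∈ys)) _ k≺y = <-asym k≺y (All.lookup y≺ys k∈ys)
  ∈-consecutive⁻ {x ∷ y ∷ ys} {a} {b} (x≺ ∷ sorted) (there ab∈) with ∈-consecutive⁻ sorted ab∈
  ... | a∈ , b∈ , a≺b , gap = there a∈ , there b∈ , a≺b , gap'
    where
    gap' : ∀ k → k ∈ x ∷ y ∷ ys → a ≺ k → k ≺ b → ⊥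
    gap' _ (here refl) a≺x _ = <-asym a≺x (All.lookup x≺ a∈)
    gap' k (there k∈) = gap k k∈

  ∈-consecutive⁺ : ∀ {L a b} → AllPairs _≺_ L → Adjacent L a b → (a , b) ∈ consecutive L
  ∈-consecutive⁺ {x ∷ []} _ (here refl , here refl , x≺x , _) = ⊥-elim (<-irrefl refl x≺x)
  ∈-consecutive⁺ {x ∷ y ∷ ys} _ (here refl , here refl , x≺x , _) = ⊥-elim (<-irrefl refl x≺x)
  ∈-consecutive⁺ {x ∷ y ∷ ys} _ (here refl , there (here refl) , _ , _) = here refl
  ∈-consecutive⁺ {x ∷ y ∷ ys} ((x≺y ∷ _) ∷ (y≺ys ∷ _)) (here refl , there (there b∈) , _ , gap) =
    ⊥-elim (gap y (there (here refl)) x≺y (All.lookup y≺ys b∈))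
  ∈-consecutive⁺ {x ∷ y ∷ ys} (x≺ ∷ _) (there a∈ , here refl , a≺x , _) = ⊥-elim (<-asym a≺x (All.lookup x≺ a∈))
  ∈-consecutive⁺ {x ∷ y ∷ ys} (_ ∷ sorted) (there a∈ , there b∈ , a≺b , gap) =
    there (∈-consecutive⁺ sorted (a∈ , b∈ , a≺b , λ k k∈ → gap k (there k∈)))

  consecutive-predecessor : ∀ {L x a} → AllPairs _≺_ L → x ∈ L → a ∈ L → a ≺ x →
                            ∃ λ a' → (a' , x) ∈ consecutive L
  consecutive-predecessor _ (here refl) (here refl) x≺x = ⊥-elim (<-irrefl refl x≺x)
  consecutive-predecessor (x≺ ∷ _) (here refl) (there a∈) a≺x = ⊥-elim (<-asym a≺x (All.lookup x≺ a∈))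
  consecutive-predecessor {x ∷ y ∷ ys} _ (there (here refl)) _ _ = x , here refl
  consecutive-predecessor {x ∷ y ∷ ys} (_ ∷ sorted@(y≺ys ∷ _)) (there (there x∈)) _ _
    with consecutive-predecessor sorted (there x∈) (here refl) (All.lookup y≺ys x∈)
  ... | a' , a'x∈ = a' , there a'x∈

  consecutive-successor : ∀ {L x b} → AllPairs _≺_ L → x ∈ L → b ∈ L → x ≺ b →
                          ∃ λ b' → (x , b') ∈ consecutive L
  consecutive-successor _ (here refl) (here refl) x≺x = ⊥-elim (<-irrefl refl x≺x)
  consecutive-successor {x ∷ y ∷ ys} _ (here refl) (there _) _ = y , here refl
  consecutive-successor (y≺ ∷ _) (there x∈) (here refl) x≺y = ⊥-elim (<-asym x≺y (All.lookup y≺ x∈))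
  consecutive-successor {x ∷ y ∷ ys} (_ ∷ sorted) (there x∈) (there b∈) x≺b
    with consecutive-successor sorted x∈ b∈ x≺b
  ... | b' , xb'∈ = b' , there xb'∈

members : Family → Fam
members L I = I ∈ L

∈-restrict⁻ : ∀ {L s I} → I ∈ restrict L s → I ∈ L × I ⊆ᵢ s
∈-restrict⁻ {s = s} = ∈-filter⁻ (_⊆? s)

∈-restrict⁺ : ∀ {L s I} → I ∈ L → I ⊆ᵢ s → I ∈ restrict L s
∈-restrict⁺ {s = s} = ∈-filter⁺ (_⊆? s)

module _ {L : Family} {s : Interval} where

  private
    unsurpassed? : (I : Interval) → Dec _
    unsurpassed? I = ¬? (any? (I ⊂?_) (restrict L s))

  ∈-maximals⁻ : ∀ {I} → I ∈ maximals L s → Maximal (members L) s I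
  ∈-maximals⁻ {I} I∈ with ∈-filter⁻ unsurpassed? (∈-resp-↭ (sort-↭ _) I∈)
  ... | I∈L|s , ¬larger = let I∈L , I⊆s = ∈-restrict⁻ I∈L|s in
    I∈L , I⊆s , λ J J∈L J⊆s I⊂J → ¬larger (lose (∈-restrict⁺ J∈L J⊆s) I⊂J)

  ∈-maximals⁺ : ∀ {I} → Maximal (members L) s I → I ∈ maximals L s
  ∈-maximals⁺ {I} (I∈L , I⊆s , maxI) =
    ∈-resp-↭ (↭-sym (sort-↭ _)) (∈-filter⁺ unsurpassed? (∈-restrict⁺ I∈L I⊆s) λ larger →
      let J , J∈L|s , I⊂J = find larger ; J∈L , J⊆s = ∈-restrict⁻ J∈L|s in maxI J J∈L J⊆s I⊂J)

private
  module Lex = DecTotalOrder (×-decTotalOrder ℤ.≤-decTotalOrder ℤ.≤-decTotalOrder)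

open SortedBy lft using (∈-consecutive⁻; ∈-consecutive⁺; consecutive-predecessor; consecutive-successor)

maximals-sorted : ∀ {L s} → Unique L → AllPairs (_<_ on lft) (maximals L s)
maximals-sorted {L} {s} uL =
  Linked⇒AllPairs <-trans
    (strict (sort-↗ _) (Unique-resp-↭ (↭⇒↭ₛ (↭-sym (sort-↭ _))) (Unique.filter⁺ _ (Unique.filter⁺ _ uL)))
            (All.tabulate ∈-maximals⁻))
  where
  strict : ∀ {xs} → Linked Lex._≤_ xs → Unique xs → All (Maximal (members L) s) xs → Linked (_<_ on lft) xs
  strict [] _ _ = []
  strict [-] _ _ = [-]
  strict (inj₁ (x≤y , x≢y) ∷ sorted) (_ ∷ u) (_ ∷ my ∷ ms) = ℤ.≤∧≢⇒< x≤y x≢y ∷ strict sorted u (my ∷ ms)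
  strict (inj₂ (x≡y , _) ∷ _) ((x≢y ∷ _) ∷ _) (mx ∷ my ∷ _) =
    ⊥-elim (x≢y (Maximals.lft-injective _ s mx my x≡y))

module _ {L : Family} (uL : Unique L) {s : Interval} where

  ∈-consecutive-maximals⁻ : ∀ {A B} → (A , B) ∈ consecutive (maximals L s) → Consecutive (members L) s A B
  ∈-consecutive-maximals⁻ AB∈ with ∈-consecutive⁻ (maximals-sorted uL) AB∈
  ... | A∈ , B∈ , A<B , gap = ∈-maximals⁻ A∈ , ∈-maximals⁻ B∈ , A<B , λ K mK → gap K (∈-maximals⁺ mK)

  ∈-consecutive-maximals⁺ : ∀ {A B} → Consecutive (members L) s A B → (A , B) ∈ consecutive (maximals L s)
  ∈-consecutive-maximals⁺ (mA , mB , A<B , gap) =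
    ∈-consecutive⁺ (maximals-sorted uL)
      (∈-maximals⁺ mA , ∈-maximals⁺ mB , A<B , λ K K∈ → gap K (∈-maximals⁻ K∈))

  members-↓ : members (L ↓ s) ≐ Down (members L) s
  members-↓ = to , from
    where
    kept? : (I : Interval) → Dec _
    kept? I = ¬? (I ∈? maximals L s)
    to : members (L ↓ s) ⊆ Down (members L) s
    to I∈ with ∈-++⁻ (filter kept? L) (∈-deduplicate⁻ _≟ᵢ_ _ I∈)
    ... | inj₁ I∈kept = let I∈L , ¬max = ∈-filter⁻ kept? I∈kept in inj₁ (I∈L , λ mI → ¬max (∈-maximals⁺ mI))
    ... | inj₂ I∈new with ∈-map⁻ _ I∈new
    ... | (A , B) , AB∈ , refl = inj₂ (A , B , ∈-consecutive-maximals⁻ AB∈ , refl)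
    from : Down (members L) s ⊆ members (L ↓ s)
    from (inj₁ (I∈L , ¬max)) =
      ∈-deduplicate⁺ _≟ᵢ_ (∈-++⁺ˡ (∈-filter⁺ kept? I∈L (λ I∈max → ¬max (∈-maximals⁻ I∈max))))
    from (inj₂ (A , B , c , refl)) = ∈-deduplicate⁺ _≟ᵢ_ (∈-++⁺ʳ _ (∈-map⁺ _ (∈-consecutive-maximals⁺ c)))

  downDefined : (∀ {A B} → Consecutive (members L) s A B → lft B < rgt A) → DownDefined L s
  downDefined overlaps = All.tabulate λ AB∈ → overlaps (∈-consecutive-maximals⁻ AB∈)

module _ {X : Set} where

  ∈-∈-≢⇒2≤length : ∀ {a b : X} {xs} → a ∈ xs → b ∈ xs → a ≢ b → 2 ℕ.≤ length xs
  ∈-∈-≢⇒2≤length (here refl) (here refl) a≢b = ⊥-elim (a≢b refl)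
  ∈-∈-≢⇒2≤length (here refl) (there b∈) _ = ℕ.s≤s (∈-length b∈)
  ∈-∈-≢⇒2≤length (there a∈) (here refl) _ = ℕ.s≤s (∈-length a∈)
  ∈-∈-≢⇒2≤length (there a∈) (there b∈) a≢b = ℕₚ.m≤n⇒m≤1+n (∈-∈-≢⇒2≤length a∈ b∈ a≢b)

  2≤length⇒distinct : ∀ {xs : List X} → 2 ℕ.≤ length xs → Unique xs → ∃₂ λ a b → a ≢ b × a ∈ xs × b ∈ xs
  2≤length⇒distinct {_ ∷ []} (ℕ.s≤s ()) _
  2≤length⇒distinct {_ ∷ _ ∷ _} _ ((a≢b ∷ _) ∷ _) = _ , _ , a≢b , here refl , there (here refl)

width : Interval → ℤ
width I = rgt I - lft I

⊂ᵢ⇒width< : ∀ {I J} → I ⊂ᵢ J → width I < width J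
⊂ᵢ⇒width< {I} {J} ((J≤I , I≤J) , I≢J) with rgt I <? rgt J | lft J <? lft I
... | yes I<J | _ = ℤ.+-mono-<-≤ I<J (ℤ.neg-mono-≤ J≤I)
... | no _ | yes J<I = ℤ.+-mono-≤-< I≤J (ℤ.neg-mono-< J<I)
... | no I≮J | no J≮I = ⊥-elim (I≢J (cong₂ _,_ (≤-antisym (≮⇒≥ J≮I) J≤I) (≤-antisym I≤J (≮⇒≥ I≮J))))

maximal-above : ∀ {F s K} → K ∈ F → K ⊆ᵢ s → ∃ λ J → Maximal (members F) s J × K ⊆ᵢ J
maximal-above {F} {s} {K} K∈F K⊆s = J , (J∈F , J⊆s , widest) , K⊆J
  where
  between? : (J : Interval) → Dec _
  between? J = (K ⊆? J) ×-dec (J ⊆? s)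
  candidates : List Interval
  candidates = filter between? F
  J : Interval
  J = argmax width K candidates
  J∈F×K⊆J×J⊆s : J ∈ F × K ⊆ᵢ J × J ⊆ᵢ s
  J∈F×K⊆J×J⊆s = argmax-all width (K∈F , ⊆ᵢ-refl , K⊆s) (All.tabulate (∈-filter⁻ between?))
  J∈F = proj₁ J∈F×K⊆J×J⊆s
  K⊆J = proj₁ (proj₂ J∈F×K⊆J×J⊆s)
  J⊆s = proj₂ (proj₂ J∈F×K⊆J×J⊆s)
  widest : ∀ L → L ∈ F → L ⊆ᵢ s → ¬ J ⊂ᵢ L
  widest L L∈F L⊆s J⊂L = <-irrefl refl (<-≤-trans (⊂ᵢ⇒width< J⊂L)
    (All.lookup (f[xs]≤f[argmax] K candidates) (∈-filter⁺ between? L∈F (⊆ᵢ-trans K⊆J (proj₁ J⊂L) , L⊆s))))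

isMinimalBad : ∀ {F s} → Unique F → All IsInterval F → MinimalBad F s → IsMinimalBad (members F) s
isMinimalBad {F} {s} uF nonemptyF (nonempty , bad , minimal) = record
  { nonempty = nonempty
  ; members-nonempty = All.lookup nonemptyF
  ; maximal-above = maximal-above
  ; predecessor = λ mX mA A<X →
      let A' , A'X∈ = consecutive-predecessor (maximals-sorted uF) (∈-maximals⁺ mX) (∈-maximals⁺ mA) A<X
      in A' , ∈-consecutive-maximals⁻ uF A'X∈
  ; successor = λ mX mB X<B →
      let B' , XB'∈ = consecutive-successor (maximals-sorted uF) (∈-maximals⁺ mX) (∈-maximals⁺ mB) X<B
      in B' , ∈-consecutive-maximals⁻ uF XB'∈
  ; maximal? = λ J → map′ ∈-maximals⁻ ∈-maximals⁺ (J ∈? maximals F s)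
  ; covered-twice = covered-twice
  ; proper-good = proper-good
  }
  where
  covered-twice : ∀ {x} → s ∋ x → CoveredTwice (members F) s x
  covered-twice {x} s∋x
    with 2≤length⇒distinct (ℕₚ.≰⇒> λ N≤1 → bad (x , s∋x , N≤1)) (Unique.filter⁺ _ (Unique.filter⁺ _ uF))
  ... | A , B , A≢B , A∈ , B∈ = A , B , A≢B , covers A∈ , covers B∈
    where
    covers : ∀ {I} → I ∈ filter (_∋? x) (restrict F s) → Covers (members F) s x I
    covers I∈ = let I∈F|s , I∋x = ∈-filter⁻ (_∋? x) I∈ ; I∈F , I⊆s = ∈-restrict⁻ I∈F|s in I∈F , I⊆s , I∋x
  proper-good : ∀ {v} → IsInterval v → v ⊆ᵢ s → v ≢ s → ¬ ¬ (∃ λ x → v ∋ x × CoveredAtMostOnce (members F) v x)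
  proper-good v-nonempty v⊆s v≢s no-point = minimal _ v-nonempty v⊆s v≢s λ (x , v∋x , N≤1) →
    no-point (x , v∋x , λ (A∈F , A⊆v , A∋x) (B∈F , B⊆v , B∋x) → decidable-stable (_ ≟ᵢ _) λ A≢B →
      ℕₚ.≤⇒≯ N≤1 (∈-∈-≢⇒2≤length (∈-filter⁺ (_∋? x) (∈-restrict⁺ A∈F A⊆v) A∋x)
                                 (∈-filter⁺ (_∋? x) (∈-restrict⁺ B∈F B⊆v) B∋x) A≢B))

maximal-resp-≐ : ∀ {𝔽 𝔾 s} → 𝔽 ≐ 𝔾 → Maximal 𝔽 s ⊆ Maximal 𝔾 s
maximal-resp-≐ (𝔽⊆𝔾 , 𝔾⊆𝔽) (fI , I⊆s , maxI) = 𝔽⊆𝔾 fI , I⊆s , λ J gJ → maxI J (𝔾⊆𝔽 gJ)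

consecutive-resp-≐ : ∀ {𝔽 𝔾 s} → 𝔽 ≐ 𝔾 → ∀ {A B} → Consecutive 𝔽 s A B → Consecutive 𝔾 s A B
consecutive-resp-≐ eq (mA , mB , A<B , gap) =
  maximal-resp-≐ eq mA , maximal-resp-≐ eq mB , A<B , λ K mK → gap K (maximal-resp-≐ (≐-sym eq) mK)

down-resp-⊆ : ∀ {𝔽 𝔾 s} → 𝔽 ≐ 𝔾 → Down 𝔽 s ⊆ Down 𝔾 s
down-resp-⊆ eq (inj₁ (fI , ¬maxI)) = inj₁ (proj₁ eq fI , λ maxI → ¬maxI (maximal-resp-≐ (≐-sym eq) maxI))
down-resp-⊆ eq (inj₂ (A , B , c , I≡)) = inj₂ (A , B , consecutive-resp-≐ eq c , I≡)

members-↓↓ : ∀ {F s t} → Unique F → members ((F ↓ s) ↓ t) ≐ Down (Down (members F) s) t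
members-↓↓ uF =
  ≐-trans (members-↓ (deduplicate-! _)) (down-resp-⊆ (members-↓ uF) , down-resp-⊆ (≐-sym (members-↓ uF)))

module Ordered {F : Family} (uF : Unique F) (nonemptyF : All IsInterval F) {s t : Interval}
               (mbs : MinimalBad F s) (mbt : MinimalBad F t) (p<p' : lft s < lft t) where
  open TwoMinimalBadIntervals (isMinimalBad uF nonemptyF mbs) (isMinimalBad uF nonemptyF mbt) p<p'

  downDefined-↓s-t : DownDefined (F ↓ s) t
  downDefined-↓s-t =
    downDefined (deduplicate-! _) λ c → ↓s-consecutiveᵗ-overlap (consecutive-resp-≐ (members-↓ uF) c)

  downDefined-↓t-s : DownDefined (F ↓ t) s
  downDefined-↓t-s =
    downDefined (deduplicate-! _) λ c → ↓t-consecutiveˢ-overlap (consecutive-resp-≐ (members-↓ uF) c)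

  ↓-comm : (F ↓ s) ↓ t ≈F (F ↓ t) ↓ s
  ↓-comm I = (λ I∈ → proj₂ (members-↓↓ uF) (common⇒↓t↓s (↓s↓t⇒common (proj₁ (members-↓↓ uF) I∈))))
           , (λ I∈ → proj₂ (members-↓↓ uF) (common⇒↓s↓t (↓t↓s⇒common (proj₁ (members-↓↓ uF) I∈))))

minimalBad-lft-injective : ∀ {F s t} → MinimalBad F s → MinimalBad F t → lft s ≡ lft t → s ≡ t
minimalBad-lft-injective {s = s} {t} (s-nonempty , s-bad , s-minimal) (t-nonempty , t-bad , t-minimal) eq =
  decidable-stable (s ≟ᵢ t) λ s≢t → case ≤-total (rgt s) (rgt t) of λ where
    (inj₁ s≤t) → t-minimal s s-nonempty (≤-reflexive (sym eq) , s≤t) s≢t s-bad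
    (inj₂ t≤s) → s-minimal t t-nonempty (≤-reflexive eq , t≤s) (λ t≡s → s≢t (sym t≡s)) t-bad

mainTheorem9 : (F : Family) → Unique F → All IsInterval F →
    (s t : Interval) → MinimalBad F s → MinimalBad F t → s ≢ t →
    DownDefined (F ↓ s) t × DownDefined (F ↓ t) s × ((F ↓ s) ↓ t ≈F (F ↓ t) ↓ s)
mainTheorem9 F uF nonemptyF s t mbs mbt s≢t with <-cmp (lft s) (lft t)
... | tri< s<t _ _ = let open Ordered uF nonemptyF mbs mbt s<t in downDefined-↓s-t , downDefined-↓t-s , ↓-comm
... | tri> _ _ t<s = let open Ordered uF nonemptyF mbt mbs t<s in
  downDefined-↓t-s , downDefined-↓s-t , λ I → swap (↓-comm I)
... | tri≈ _ s≡t _ = ⊥-elim (s≢t (minimalBad-lft-injective {F} mbs mbt s≡t))
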